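{- Let $\Gamma$ be an $\mathrm{rca}(n,k,\omega)$ and let $u$ and $v$ be distinct non-adjacent vertices of $\Gamma$. Then $|N(u)\cap N(v)|\le \frac{k}{\omega-1}$.
   Context: All graphs are finite, without loops or parallel edges; $N(x)$ denotes the set of neighbors of a vertex $x$. A regular clique assembly is a regular graph with clique number at least $2$ in which every maximal clique is maximum (of order equal to the clique number) and every edge belongs to exactly one maximum clique. An $\mathrm{rca}(n,k,\omega)$ is a regular clique assembly on $n$ vertices that is $k$-regular with clique number $\omega$. -}

module Defs where

open import Data.Nat using (ℕ; _≤_; _*_; _∸_)
open import Data.Bool using (Bool; true; false)
open import Data.Fin using (Fin)
open import Data.Fin.Subset using (Subset; _∈_; _∉_; _⊆_; ∣_∣; _∩_)
open import Data.Vec using (tabulate)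
open import Data.Product using (Σ; _×_; ∃)
open import Relation.Binary.PropositionalEquality using (_≡_; _≢_)

record Graph (n : ℕ) : Set where
  field
    adj     : Fin n → Fin n → Bool
    symm    : ∀ x y → adj x y ≡ adj y x
    irrefl  : ∀ x → adj x x ≡ false

module _ {n : ℕ} (G : Graph n) where
  open Graph G

  Adjacent : Fin n → Fin n → Set
  Adjacent x y = adj x y ≡ true

  N : Fin n → Subset n
  N x = tabulate (adj x)

  Regular : ℕ → Set
  Regular k = ∀ x → ∣ N x ∣ ≡ k

  IsClique : Subset n → Set
  IsClique S = ∀ x y → x ∈ S → y ∈ S → x ≢ y → Adjacent x y

  IsMaximalClique : Subset n → Set
  IsMaximalClique S = IsClique S × (∀ T → IsClique T → S ⊆ T → T ⊆ S)

  CliqueNumber : ℕ → Set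
  CliqueNumber ω = (Σ (Subset n) λ S → IsClique S × ∣ S ∣ ≡ ω)
                 × (∀ S → IsClique S → ∣ S ∣ ≤ ω)

  IsMaximumClique : ℕ → Subset n → Set
  IsMaximumClique ω S = IsClique S × ∣ S ∣ ≡ ω

  IsRCA : ℕ → ℕ → Set
  IsRCA k ω =
      Regular k
    × CliqueNumber ω
    × 2 ≤ ω
    × (∀ S → IsMaximalClique S → IsMaximumClique ω S)
    × (∀ x y → Adjacent x y →
         Σ (Subset n) λ S → IsMaximumClique ω S × x ∈ S × y ∈ S
           × (∀ T → IsMaximumClique ω T → x ∈ T → y ∈ T → T ≡ S))

-- For a common neighbour w of u and v let C w be the maximum clique through the edge uw.
-- The sets C w - u lie in N u and have ω - 1 elements each.  They are pairwise disjoint: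
-- a shared vertex x ≠ u forces C w = C x = C w′, so w and w′ are adjacent; u and v both
-- complete triangles on the edge ww′, and a triangle extends to a maximal, hence maximum,
-- clique, which must be the clique of ww′.  So u and v lie in one clique, contradicting u ≁ v.
-- Disjointness gives ∣N u ∩ N v∣ · (ω - 1) ≤ ∣N u∣ = k.

{-# OPTIONS --safe #-}
module Submission where

open import Defs
open import Data.Nat using (ℕ; _+_; _≤_; _*_; _∸_; z≤n)
open import Data.Nat.Properties using (+-suc; +-mono-≤; ≤-reflexive; module ≤-Reasoning)
open import Data.Bool using (true) renaming (_≟_ to _≟ᵇ_)
open import Data.Fin using (Fin; zero; suc)
open import Data.Fin.Properties using (any?; all?; suc-injective) renaming (_≟_ to _≟ᶠ_)
open import Data.Fin.Subset
open import Data.Fin.Subset.Properties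
open import Data.Fin.Subset.Induction using (Acc; acc; ⊃-wellFounded)
open import Data.Vec using (_∷_; []; here; there)
open import Data.Vec.Properties using ([]=⇒lookup; lookup⇒[]=; lookup∘tabulate)
open import Data.Product using (Σ; _×_; ∃; _,_; proj₁; proj₂)
open import Data.Sum using (inj₁; inj₂; [_,_]′)
open import Function using (id; _∘_)
open import Relation.Binary.PropositionalEquality
open import Relation.Nullary using (¬_; Dec; yes; no; contradiction)
open import Relation.Nullary.Decidable using (¬?; _×-dec_; _→-dec_)

private
  variable
    n m : ℕ

x∈p─q⇒x∉q : ∀ {x : Fin n} (p q : Subset n) → x ∈ p ─ q → x ∉ q
x∈p─q⇒x∉q (_ ∷ p) (outside ∷ q) here       ()
x∈p─q⇒x∉q (_ ∷ p) (_       ∷ q) (there x∈) (there x∈q) = x∈p─q⇒x∉q p q x∈ x∈q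

q⊆p⇒∣q∣+∣p─q∣≡∣p∣ : ∀ (p q : Subset n) → q ⊆ p → ∣ q ∣ + ∣ p ─ q ∣ ≡ ∣ p ∣
q⊆p⇒∣q∣+∣p─q∣≡∣p∣ []            []            _   = refl
q⊆p⇒∣q∣+∣p─q∣≡∣p∣ (outside ∷ p) (outside ∷ q) q⊆p = q⊆p⇒∣q∣+∣p─q∣≡∣p∣ p q (drop-∷-⊆ q⊆p)
q⊆p⇒∣q∣+∣p─q∣≡∣p∣ (inside  ∷ p) (outside ∷ q) q⊆p =
  trans (+-suc ∣ q ∣ ∣ p ─ q ∣) (cong (1 +_) (q⊆p⇒∣q∣+∣p─q∣≡∣p∣ p q (drop-∷-⊆ q⊆p)))
q⊆p⇒∣q∣+∣p─q∣≡∣p∣ (inside  ∷ p) (inside  ∷ q) q⊆p = cong (1 +_) (q⊆p⇒∣q∣+∣p─q∣≡∣p∣ p q (drop-∷-⊆ q⊆p))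
q⊆p⇒∣q∣+∣p─q∣≡∣p∣ (outside ∷ p) (inside  ∷ q) q⊆p with q⊆p here
... | ()

⁅x⁆⊆p : ∀ {x : Fin n} {p} → x ∈ p → ⁅ x ⁆ ⊆ p
⁅x⁆⊆p {x = x} {p} x∈p y∈⁅x⁆ = subst (_∈ p) (sym (x∈⁅y⁆⇒x≡y x y∈⁅x⁆)) x∈p

x∈p⇒∣p-x∣≡∣p∣∸1 : ∀ {x : Fin n} {p} → x ∈ p → ∣ p - x ∣ ≡ ∣ p ∣ ∸ 1
x∈p⇒∣p-x∣≡∣p∣∸1 {x = x} {p} x∈p = cong (_∸ 1) (begin
  1 + ∣ p - x ∣       ≡⟨ cong (_+ ∣ p - x ∣) (sym (∣⁅x⁆∣≡1 x)) ⟩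
  ∣ ⁅ x ⁆ ∣ + ∣ p - x ∣ ≡⟨ q⊆p⇒∣q∣+∣p─q∣≡∣p∣ p ⁅ x ⁆ (⁅x⁆⊆p x∈p) ⟩
  ∣ p ∣               ∎)
  where open ≡-Reasoning

pairwise-disjoint⇒∣I∣*c≤∣p∣ :
  ∀ {c} (I : Subset n) {p : Subset m} (F : ∀ i → i ∈ I → Subset m) →
  (∀ i i∈I → F i i∈I ⊆ p) →
  (∀ i i∈I → c ≤ ∣ F i i∈I ∣) →
  (∀ {i j x} i∈I j∈I → i ≢ j → x ∈ F i i∈I → x ∉ F j j∈I) →
  ∣ I ∣ * c ≤ ∣ p ∣
pairwise-disjoint⇒∣I∣*c≤∣p∣ [] F _ _ _ = z≤n
pairwise-disjoint⇒∣I∣*c≤∣p∣ (outside ∷ I) F F⊆p c≤∣F∣ disjoint =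
  pairwise-disjoint⇒∣I∣*c≤∣p∣ I (λ i → F (suc i) ∘ there)
    (λ i → F⊆p (suc i) ∘ there) (λ i → c≤∣F∣ (suc i) ∘ there)
    (λ i∈I j∈I i≢j → disjoint (there i∈I) (there j∈I) (i≢j ∘ suc-injective))
pairwise-disjoint⇒∣I∣*c≤∣p∣ {m = m} {c = c} (inside ∷ I) {p} F F⊆p c≤∣F∣ disjoint = begin
  c + ∣ I ∣ * c              ≤⟨ +-mono-≤ (c≤∣F∣ zero here) rest ⟩
  ∣ F₀ ∣ + ∣ p ─ F₀ ∣        ≡⟨ q⊆p⇒∣q∣+∣p─q∣≡∣p∣ p F₀ (F⊆p zero here) ⟩
  ∣ p ∣                      ∎
  where
  open ≤-Reasoning
  F₀ : Subset m
  F₀ = F zero here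
  rest : ∣ I ∣ * c ≤ ∣ p ─ F₀ ∣
  rest = pairwise-disjoint⇒∣I∣*c≤∣p∣ I (λ i → F (suc i) ∘ there)
    (λ i i∈I x∈F → x∈p∧x∉q⇒x∈p─q (F⊆p (suc i) (there i∈I) x∈F) (disjoint (there i∈I) here (λ ()) x∈F))
    (λ i → c≤∣F∣ (suc i) ∘ there)
    (λ i∈I j∈I i≢j → disjoint (there i∈I) (there j∈I) (i≢j ∘ suc-injective))

module _ {P : Subset n → Set} (P? : ∀ S → Dec (P S)) (P-⊆ : ∀ {S T} → S ⊆ T → P T → P S) where

  ⊆-maximal : ∀ {S} → P S → ∃ λ M → (P M × (∀ T → P T → M ⊆ T → T ⊆ M)) × S ⊆ M
  ⊆-maximal {S} = extend (⊃-wellFounded S)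
    where
    extend : ∀ {S} → Acc _⊃_ S → P S → ∃ λ M → (P M × (∀ T → P T → M ⊆ T → T ⊆ M)) × S ⊆ M
    extend {S} (acc larger) PS with any? (λ x → ¬? (x ∈? S) ×-dec P? (⁅ x ⁆ ∪ S))
    ... | yes (x , x∉S , P⁅x⁆∪S) =
      let M , M-maximal , ⁅x⁆∪S⊆M = extend (larger S⊂⁅x⁆∪S) P⁅x⁆∪S
      in M , M-maximal , ⁅x⁆∪S⊆M ∘ q⊆p∪q ⁅ x ⁆ S
      where
      S⊂⁅x⁆∪S : S ⊂ ⁅ x ⁆ ∪ S
      S⊂⁅x⁆∪S = q⊆p∪q ⁅ x ⁆ S , x , x∈p∪q⁺ (inj₁ (x∈⁅x⁆ x)) , x∉S
    ... | no no-extension = S , (PS , maximal) , id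
      where
      maximal : ∀ T → P T → S ⊆ T → T ⊆ S
      maximal T PT S⊆T {y} y∈T with y ∈? S
      ... | yes y∈S = y∈S
      ... | no  y∉S = contradiction
        (y , y∉S , P-⊆ ([ ⁅x⁆⊆p y∈T , S⊆T ]′ ∘ x∈p∪q⁻ ⁅ y ⁆ S) PT) no-extension

module _ (G : Graph n) where
  open Graph G

  adjacent-sym : ∀ {x y} → Adjacent G x y → Adjacent G y x
  adjacent-sym {x} {y} xy = trans (symm y x) xy

  ∈N⇒adjacent : ∀ {x y} → y ∈ N G x → Adjacent G x y
  ∈N⇒adjacent {x} {y} y∈Nx = trans (sym (lookup∘tabulate (adj x) y)) ([]=⇒lookup y∈Nx)

  adjacent⇒∈N : ∀ {x y} → Adjacent G x y → y ∈ N G x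
  adjacent⇒∈N {x} {y} xy = lookup⇒[]= y (N G x) (trans (lookup∘tabulate (adj x) y) xy)

  isClique? : ∀ S → Dec (IsClique G S)
  isClique? S = all? λ x → all? λ y →
    (x ∈? S) →-dec ((y ∈? S) →-dec (¬? (x ≟ᶠ y) →-dec (adj x y ≟ᵇ true)))

  isClique-⊆ : ∀ {S T} → S ⊆ T → IsClique G T → IsClique G S
  isClique-⊆ S⊆T T-clique x y x∈S y∈S = T-clique x y (S⊆T x∈S) (S⊆T y∈S)

  ⊆-maximalClique : ∀ {S} → IsClique G S → ∃ λ M → IsMaximalClique G M × S ⊆ M
  ⊆-maximalClique = ⊆-maximal isClique? isClique-⊆

  isClique-⁅x⁆ : ∀ {x} → IsClique G ⁅ x ⁆
  isClique-⁅x⁆ {x} y z y∈⁅x⁆ z∈⁅x⁆ y≢z =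
    contradiction (trans (x∈⁅y⁆⇒x≡y x y∈⁅x⁆) (sym (x∈⁅y⁆⇒x≡y x z∈⁅x⁆))) y≢z

  isClique-⁅x⁆∪ : ∀ {x S} → IsClique G S → (∀ {y} → y ∈ S → Adjacent G x y) → IsClique G (⁅ x ⁆ ∪ S)
  isClique-⁅x⁆∪ {x} {S} S-clique x∼S y z y∈ z∈ y≢z with x∈p∪q⁻ ⁅ x ⁆ S y∈ | x∈p∪q⁻ ⁅ x ⁆ S z∈
  ... | inj₁ y∈⁅x⁆ | inj₁ z∈⁅x⁆ = isClique-⁅x⁆ y z y∈⁅x⁆ z∈⁅x⁆ y≢z
  ... | inj₁ y∈⁅x⁆ | inj₂ z∈S   = subst (λ y → Adjacent G y z) (sym (x∈⁅y⁆⇒x≡y x y∈⁅x⁆)) (x∼S z∈S)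
  ... | inj₂ y∈S   | inj₁ z∈⁅x⁆ = subst (Adjacent G y) (sym (x∈⁅y⁆⇒x≡y x z∈⁅x⁆)) (adjacent-sym (x∼S y∈S))
  ... | inj₂ y∈S   | inj₂ z∈S   = S-clique y z y∈S z∈S y≢z

  adjacent-⁅⁆ : ∀ {x y} → Adjacent G x y → ∀ {z} → z ∈ ⁅ y ⁆ → Adjacent G x z
  adjacent-⁅⁆ {x} {y} xy z∈⁅y⁆ = subst (Adjacent G x) (sym (x∈⁅y⁆⇒x≡y y z∈⁅y⁆)) xy

  isClique-triangle : ∀ {x y z} → Adjacent G x y → Adjacent G x z → Adjacent G y z →
                      IsClique G (⁅ z ⁆ ∪ (⁅ x ⁆ ∪ ⁅ y ⁆))
  isClique-triangle {x} {y} xy xz yz =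
    isClique-⁅x⁆∪ (isClique-⁅x⁆∪ isClique-⁅x⁆ (adjacent-⁅⁆ xy))
      ([ adjacent-⁅⁆ (adjacent-sym xz) , adjacent-⁅⁆ (adjacent-sym yz) ]′ ∘ x∈p∪q⁻ ⁅ x ⁆ ⁅ y ⁆)

  isClique⇒p-x⊆N : ∀ {S x} → IsClique G S → x ∈ S → S - x ⊆ N G x
  isClique⇒p-x⊆N {S} {x} S-clique x∈S {y} y∈S-x = adjacent⇒∈N
    (S-clique x y x∈S (p─q⊆p S ⁅ x ⁆ y∈S-x) (x∉⁅y⁆⇒x≢y (x∈p─q⇒x∉q S ⁅ x ⁆ y∈S-x) ∘ sym))

module EdgeCliques (G : Graph n) (ω : ℕ)
  (maximal⇒maximum : ∀ S → IsMaximalClique G S → IsMaximumClique G ω S)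
  (edge-clique : ∀ x y → Adjacent G x y →
    Σ (Subset n) λ S → IsMaximumClique G ω S × x ∈ S × y ∈ S
      × (∀ T → IsMaximumClique G ω T → x ∈ T → y ∈ T → T ≡ S))
  where

  clique : ∀ {x y} → Adjacent G x y → Subset n
  clique {x} {y} xy = proj₁ (edge-clique x y xy)

  clique-isMaximum : ∀ {x y} (xy : Adjacent G x y) → IsMaximumClique G ω (clique xy)
  clique-isMaximum {x} {y} xy = proj₁ (proj₂ (edge-clique x y xy))

  ∈-clique₁ : ∀ {x y} (xy : Adjacent G x y) → x ∈ clique xy
  ∈-clique₁ {x} {y} xy = proj₁ (proj₂ (proj₂ (edge-clique x y xy)))

  ∈-clique₂ : ∀ {x y} (xy : Adjacent G x y) → y ∈ clique xy
  ∈-clique₂ {x} {y} xy = proj₁ (proj₂ (proj₂ (proj₂ (edge-clique x y xy))))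

  clique-unique : ∀ {x y T} (xy : Adjacent G x y) → IsMaximumClique G ω T → x ∈ T → y ∈ T → T ≡ clique xy
  clique-unique {x} {y} {T} xy = proj₂ (proj₂ (proj₂ (proj₂ (edge-clique x y xy)))) T

  clique-x⊆N[x] : ∀ {x y} (xy : Adjacent G x y) → clique xy - x ⊆ N G x
  clique-x⊆N[x] xy = isClique⇒p-x⊆N G (proj₁ (clique-isMaximum xy)) (∈-clique₁ xy)

  ∣clique-x∣≡ω∸1 : ∀ {x y} (xy : Adjacent G x y) → ∣ clique xy - x ∣ ≡ ω ∸ 1
  ∣clique-x∣≡ω∸1 xy = trans (x∈p⇒∣p-x∣≡∣p∣∸1 (∈-clique₁ xy)) (cong (_∸ 1) (proj₂ (clique-isMaximum xy)))

  maximumCliques-sharing-two-vertices-≡ : ∀ {S T x y} → IsMaximumClique G ω S → IsMaximumClique G ω T →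
    x ∈ S → y ∈ S → x ∈ T → y ∈ T → x ≢ y → S ≡ T
  maximumCliques-sharing-two-vertices-≡ {x = x} {y} S-max T-max x∈S y∈S x∈T y∈T x≢y =
    trans (clique-unique xy S-max x∈S y∈S) (sym (clique-unique xy T-max x∈T y∈T))
    where
    xy : Adjacent G x y
    xy = proj₁ S-max x y x∈S y∈S x≢y

  triangle⇒∈clique : ∀ {x y z} (xy : Adjacent G x y) → Adjacent G x z → Adjacent G y z → z ∈ clique xy
  triangle⇒∈clique {x} {y} {z} xy xz yz with ⊆-maximalClique G (isClique-triangle G xy xz yz)
  ... | M , M-maximal , xyz⊆M =
    subst (z ∈_) (clique-unique xy (maximal⇒maximum M M-maximal) (xyz⊆M x∈xyz) (xyz⊆M y∈xyz)) (xyz⊆M z∈xyz)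
    where
    x∈xyz : x ∈ ⁅ z ⁆ ∪ (⁅ x ⁆ ∪ ⁅ y ⁆)
    x∈xyz = q⊆p∪q ⁅ z ⁆ _ (p⊆p∪q ⁅ y ⁆ (x∈⁅x⁆ x))
    y∈xyz : y ∈ ⁅ z ⁆ ∪ (⁅ x ⁆ ∪ ⁅ y ⁆)
    y∈xyz = q⊆p∪q ⁅ z ⁆ _ (q⊆p∪q ⁅ x ⁆ ⁅ y ⁆ (x∈⁅x⁆ y))
    z∈xyz : z ∈ ⁅ z ⁆ ∪ (⁅ x ⁆ ∪ ⁅ y ⁆)
    z∈xyz = p⊆p∪q (⁅ x ⁆ ∪ ⁅ y ⁆) (x∈⁅x⁆ z)

  adjacent-common-neighbours⇒adjacent : ∀ {u v w w′} → Adjacent G w w′ →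
    Adjacent G u w → Adjacent G u w′ → Adjacent G v w → Adjacent G v w′ → u ≢ v → Adjacent G u v
  adjacent-common-neighbours⇒adjacent ww′ uw uw′ vw vw′ =
    proj₁ (clique-isMaximum ww′) _ _
      (triangle⇒∈clique ww′ (adjacent-sym G uw) (adjacent-sym G uw′))
      (triangle⇒∈clique ww′ (adjacent-sym G vw) (adjacent-sym G vw′))

  common-neighbour-cliques-disjoint : ∀ {u v w w′ x} → u ≢ v → ¬ Adjacent G u v →
    (uw : Adjacent G u w) (uw′ : Adjacent G u w′) → Adjacent G v w → Adjacent G v w′ → w ≢ w′ →
    x ∈ clique uw - u → x ∉ clique uw′ - u
  common-neighbour-cliques-disjoint {u} {w = w} {w′} u≢v u≁v uw uw′ vw vw′ w≢w′ x∈C x∈C′ =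
    u≁v (adjacent-common-neighbours⇒adjacent ww′ uw uw′ vw vw′ u≢v)
    where
    C≡C′ : clique uw ≡ clique uw′
    C≡C′ = maximumCliques-sharing-two-vertices-≡ (clique-isMaximum uw) (clique-isMaximum uw′)
      (∈-clique₁ uw) (p─q⊆p _ ⁅ u ⁆ x∈C) (∈-clique₁ uw′) (p─q⊆p _ ⁅ u ⁆ x∈C′)
      (x∉⁅y⁆⇒x≢y (x∈p─q⇒x∉q _ ⁅ u ⁆ x∈C) ∘ sym)
    ww′ : Adjacent G w w′
    ww′ = proj₁ (clique-isMaximum uw) w w′ (∈-clique₂ uw) (subst (w′ ∈_) (sym C≡C′) (∈-clique₂ uw′)) w≢w′

lemma1p4 : ∀ {n k ω : ℕ} (G : Graph n) → IsRCA G k ω →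
    ∀ (u v : Fin n) → u ≢ v → ¬ Adjacent G u v →
    ∣ N G u ∩ N G v ∣ * (ω ∸ 1) ≤ k
lemma1p4 {n} {k} {ω} G (regular , _ , _ , maximal⇒maximum , edge-clique) u v u≢v u≁v = begin
  ∣ W ∣ * (ω ∸ 1)  ≤⟨ pairwise-disjoint⇒∣I∣*c≤∣p∣ W F F⊆N[u] ω∸1≤∣F∣ F-disjoint ⟩
  ∣ N G u ∣        ≡⟨ regular u ⟩
  k                ∎
  where
  open ≤-Reasoning
  open EdgeCliques G ω maximal⇒maximum edge-clique
  W : Subset n
  W = N G u ∩ N G v
  u∼ : ∀ {w} → w ∈ W → Adjacent G u w
  u∼ w∈W = ∈N⇒adjacent G (proj₁ (x∈p∩q⁻ (N G u) (N G v) w∈W))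
  v∼ : ∀ {w} → w ∈ W → Adjacent G v w
  v∼ w∈W = ∈N⇒adjacent G (proj₂ (x∈p∩q⁻ (N G u) (N G v) w∈W))
  F : ∀ w → w ∈ W → Subset n
  F w w∈W = clique (u∼ w∈W) - u
  F⊆N[u] : ∀ w w∈W → F w w∈W ⊆ N G u
  F⊆N[u] w w∈W = clique-x⊆N[x] (u∼ w∈W)
  ω∸1≤∣F∣ : ∀ w w∈W → ω ∸ 1 ≤ ∣ F w w∈W ∣
  ω∸1≤∣F∣ w w∈W = ≤-reflexive (sym (∣clique-x∣≡ω∸1 (u∼ w∈W)))
  F-disjoint : ∀ {w w′ x} w∈W w′∈W → w ≢ w′ → x ∈ F w w∈W → x ∉ F w′ w′∈W
  F-disjoint w∈W w′∈W = common-neighbour-cliques-disjoint u≢v u≁v (u∼ w∈W) (u∼ w′∈W) (v∼ w∈W) (v∼ w′∈W)
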